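{- Let $n \geq 3$ be an odd integer. Then for every integer $m \geq 2$, \[\mu_s(C_n + \overline{K_m}) \leq mn - (n+m) + 1.\]
   Context: All graphs are finite and simple. For a graph $G$ with $p=|V(G)|$ vertices and $q=|E(G)|$ edges, a super edge-magic labeling is a bijection $f: V(G)\cup E(G)\to\{1,2,\ldots,p+q\}$ with $f(V(G))=\{1,\ldots,p\}$ such that $f(x)+f(xy)+f(y)$ is the same constant for every edge $xy$; $G$ is super edge-magic if it has such a labeling. The super edge-magic deficiency $\mu_s(G)$ is the minimum nonnegative integer $t$ such that $G\cup tK_1$ (disjoint union of $G$ with $t$ isolated vertices) is super edge-magic, or $+\infty$ if no such $t$ exists. The join $G_1+G_2$ of two vertex-disjoint graphs is their union together with all edges joining a vertex of $G_1$ to a vertex of $G_2$. $C_n$ is the cycle on $n$ vertices and $\overline{K_m}$ is the graph with $m$ vertices and no edges. -}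

module Defs where

open import Data.Nat using (ℕ; zero; suc; _+_; _*_; _<_; _≤_; NonZero)
open import Data.Nat.DivMod using (_%_; m%n<n)
open import Data.Fin using (Fin; toℕ; fromℕ<; _↑ˡ_; _↑ʳ_; splitAt; remQuot)
open import Data.Sum using (_⊎_; inj₁; inj₂)
open import Data.Product using (_×_; _,_; proj₁; proj₂; Σ; ∃; ∃-syntax)
open import Function.Definitions using (Bijective)
open import Relation.Binary.PropositionalEquality using (_≡_)

-- Vertices are Fin p, edges are Fin q.
-- (Simplicity is a property of the concrete graphs below; the labeling
-- notions do not depend on it.)
record Graph : Set where
  constructor mkGraph
  field
    p    : ℕ
    q    : ℕ
    ends : Fin q → Fin p × Fin p
open Graph public

-- A super edge-magic labeling: a bijection f from V ⊎ E onto
-- {1,…,p+q} (encoded as Fin (p+q), label = toℕ + 1) with f(V) = {1,…,p}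
-- and a constant k such that f(x) + f(xy) + f(y) = k for every edge xy.
record SuperEdgeMagicLabeling (G : Graph) : Set where
  field
    f          : Fin (p G) ⊎ Fin (q G) → Fin (p G + q G)
    bijective  : Bijective _≡_ _≡_ f
    vertLabels : ∀ (v : Fin (p G)) → toℕ (f (inj₁ v)) < p G
    k          : ℕ
    magic      : ∀ (e : Fin (q G)) →
                   suc (toℕ (f (inj₁ (proj₁ (ends G e)))))
                 + suc (toℕ (f (inj₂ e)))
                 + suc (toℕ (f (inj₁ (proj₂ (ends G e))))) ≡ k

SuperEdgeMagic : Graph → Set
SuperEdgeMagic G = SuperEdgeMagicLabeling G

_∪isolated_ : Graph → ℕ → Graph
G ∪isolated t = mkGraph (p G + t) (q G)
  (λ e → (proj₁ (ends G e) ↑ˡ t) , (proj₂ (ends G e) ↑ˡ t))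

-- μ_s(G) ≤ N  (μ_s is the least t with G ∪ tK₁ super edge-magic, or +∞):
-- unfolds to: some t ≤ N makes G ∪ tK₁ super edge-magic.
SEMDeficiency≤ : Graph → ℕ → Set
SEMDeficiency≤ G N = ∃[ t ] (t ≤ N × SuperEdgeMagic (G ∪isolated t))

nextMod : ∀ {n} → Fin n → Fin n
nextMod {suc n} i = fromℕ< (m%n<n (suc (toℕ i)) (suc n))

-- Vertices: Fin (n + m); the first n vertices
-- 0,…,n-1 form the cycle (i ~ i+1 mod n), the last m vertices are the
-- independent set K̄_m.
cycleJoinEmpty : ℕ → ℕ → Graph
cycleJoinEmpty n m = mkGraph (n + m) (n + n * m) edge
  where
  edge : Fin (n + n * m) → Fin (n + m) × Fin (n + m)
  edge e with splitAt n e
  ... | inj₁ i = (i ↑ˡ m) , (nextMod i ↑ˡ m)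
  ... | inj₂ j with remQuot {n} m j
  ...   | (i , l) = (i ↑ˡ m) , (n ↑ʳ l)

module Submission where

-- Write n = 2k + 1.  Cycle vertex i is labelled k + 1 + c i, where c is the standard super
-- edge-magic labeling of the odd cycle (c i + c (i+1) = k + i + 1, with c (2k) + c 0 = k), and
-- hub l of the independent set is labelled 0, 2n, 3n, …, mn.  Then every edge sum is k + 1 + x + b n
-- with x < n: cycle edges fill block b = 1 and the edges at each hub fill the hub's own block, so the
-- n + nm edge sums are consecutive.  The n + m vertex labels are distinct and lie in [0, mn], so
-- mn + 1 − (n + m) isolated vertices take the unused labels, and numbering the edges in decreasing
-- order of their sums makes the labeling super edge-magic.

open import Defs
open import Data.Nat using (ℕ; zero; suc; _+_; _*_; _∸_; _≤_; _<_; _≥_; z≤n; s≤s; s≤s⁻¹; z<s; _<?_; NonZero)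
open import Data.Nat.Properties
open import Data.Nat.DivMod using (_%_; _/_; m≡m%n+[m/n]*n; m<n⇒m%n≡m; [m+kn]%n≡m%n; n%n≡0)
open import Data.Nat.Tactic.RingSolver using (solve-∀)
open import Data.Fin as Fin
  using (Fin; toℕ; fromℕ<; _↑ˡ_; _↑ʳ_; splitAt; join; punchOut; opposite; remQuot; quotRem; combine)
open import Data.Fin.Properties
  using (toℕ<n; toℕ-↑ˡ; toℕ-↑ʳ; ↑ˡ-injective; ↑ʳ-injective; splitAt-↑ˡ; splitAt-↑ʳ; join-splitAt;
         toℕ-fromℕ<; fromℕ<-injective; opposite-prop; opposite-involutive; punchOut-injective;
         injective⇒≤; any?; toℕ-injective; combine-remQuot)
open import Data.Sum.Properties using (inj₁-injective; inj₂-injective)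
open import Data.Vec.Functional using (_∷_)
open import Data.Sum using (_⊎_; inj₁; inj₂; [_,_]′)
open import Data.Product using (_×_; _,_; proj₁; proj₂; ∃; uncurry)
open import Function using (_∘_)
open import Function.Definitions using (Injective; Surjective)
open import Relation.Nullary using (yes; no; ¬?; contradiction)
open import Relation.Nullary.Decidable using (decidable-stable)
open import Relation.Binary.PropositionalEquality

hitsAll⊎misses : ∀ {a N} (g : Fin a → Fin N) →
  (∀ y → ∃ λ x → g x ≡ y) ⊎ (∃ λ y → ∀ x → g x ≢ y)
hitsAll⊎misses g with any? (λ y → ¬? (any? (λ x → g x Fin.≟ y)))
... | yes (y , y∉g) = inj₂ (y , λ x gx≡y → y∉g (x , gx≡y))
... | no ∄y = inj₁ λ y → decidable-stable (any? (λ x → g x Fin.≟ y)) (λ y∉g → ∄y (y , y∉g))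

injective⇒surjective : ∀ {N} {h : Fin N → Fin N} → Injective _≡_ _≡_ h → Surjective _≡_ _≡_ h
injective⇒surjective {suc N} {h} h-inj y with hitsAll⊎misses h
... | inj₁ hits = proj₁ (hits y) , λ { refl → proj₂ (hits y) }
... | inj₂ (_ , misses) = contradiction (injective⇒≤ punchOut-inj) (<⇒≱ (n<1+n N))
  where
  punchOut-inj : Injective _≡_ _≡_ (λ x → punchOut (misses x ∘ sym))
  punchOut-inj eq = h-inj (punchOut-injective (misses _ ∘ sym) (misses _ ∘ sym) eq)

injective⇒misses : ∀ {a N} {g : Fin a → Fin N} → a < N → Injective _≡_ _≡_ g → ∃ λ y → ∀ x → g x ≢ y
injective⇒misses {g = g} a<N g-inj with hitsAll⊎misses g
... | inj₂ misses = misses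
... | inj₁ hits = contradiction (injective⇒≤ preimage-inj) (<⇒≱ a<N)
  where
  preimage-inj : Injective _≡_ _≡_ (λ y → proj₁ (hits y))
  preimage-inj {y} {y′} eq = trans (sym (proj₂ (hits y))) (trans (cong g eq) (proj₂ (hits y′)))

∷-injective : ∀ {a N} {y : Fin N} {g : Fin a → Fin N} →
  (∀ x → g x ≢ y) → Injective _≡_ _≡_ g → Injective _≡_ _≡_ (y ∷ g)
∷-injective y∉g g-inj {Fin.zero}  {Fin.zero}   _  = refl
∷-injective y∉g g-inj {Fin.zero}  {Fin.suc x′} eq = contradiction (sym eq) (y∉g x′)
∷-injective y∉g g-inj {Fin.suc x} {Fin.zero}   eq = contradiction eq (y∉g x)
∷-injective y∉g g-inj {Fin.suc x} {Fin.suc x′} eq = cong Fin.suc (g-inj eq)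

freshInjection : ∀ t {a N} (g : Fin a → Fin N) → Injective _≡_ _≡_ g → a + t ≤ N →
  ∃ λ (c : Fin t → Fin N) → Injective _≡_ _≡_ c × (∀ r x → c r ≢ g x)
freshInjection zero _ _ _ = (λ ()) , (λ {}) , (λ ())
freshInjection (suc t) {a} {N} g g-inj a+t<N
  with y , y∉g ← injective⇒misses (≤-trans (m<m+n a z<s) a+t<N) g-inj
  with c , c-inj , c∉y∷g ← freshInjection t (y ∷ g) (∷-injective y∉g g-inj) (subst (_≤ N) (+-suc a t) a+t<N)
  = y ∷ c , ∷-injective (λ r → c∉y∷g r Fin.zero) c-inj , y∷c∉g
  where
  y∷c∉g : ∀ r x → (y ∷ c) r ≢ g x
  y∷c∉g Fin.zero    x = y∉g x ∘ sym
  y∷c∉g (Fin.suc r) x = c∉y∷g r (Fin.suc x)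

splitAt-injective : ∀ m {n} → Injective _≡_ _≡_ (splitAt m {n})
splitAt-injective m {n} {x} {y} eq =
  trans (sym (join-splitAt m n x)) (trans (cong (join m n) eq) (join-splitAt m n y))

↑ˡ≢↑ʳ : ∀ {m n} (i : Fin m) (j : Fin n) → i ↑ˡ n ≢ m ↑ʳ j
↑ˡ≢↑ʳ {m} {n} i j eq with () ← trans (sym (splitAt-↑ˡ m i n)) (trans (cong (splitAt m) eq) (splitAt-↑ʳ m n j))

opposite-injective : ∀ {n} → Injective _≡_ _≡_ (opposite {n})
opposite-injective {x = x} {y} eq =
  trans (sym (opposite-involutive x)) (trans (cong opposite eq) (opposite-involutive y))

[,]-injective : ∀ {A B C : Set} {f : A → C} {g : B → C} →
  Injective _≡_ _≡_ f → Injective _≡_ _≡_ g → (∀ x y → f x ≢ g y) → Injective _≡_ _≡_ [ f , g ]′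
[,]-injective f-inj g-inj f≢g {inj₁ x} {inj₁ x′} eq = cong inj₁ (f-inj eq)
[,]-injective f-inj g-inj f≢g {inj₁ x} {inj₂ y}  eq = contradiction eq (f≢g x y)
[,]-injective f-inj g-inj f≢g {inj₂ y} {inj₁ x}  eq = contradiction (sym eq) (f≢g x y)
[,]-injective f-inj g-inj f≢g {inj₂ y} {inj₂ y′} eq = cong inj₂ (g-inj eq)

toFin : ∀ {A : Set} {N} (h : A → ℕ) → (∀ x → h x < N) → A → Fin N
toFin h h< x = fromℕ< (h< x)

toFin-injective : ∀ {A : Set} {N} {h : A → ℕ} (h< : ∀ x → h x < N) →
  Injective _≡_ _≡_ h → Injective _≡_ _≡_ (toFin h h<)
toFin-injective {h = h} h< h-inj {x} {y} eq = h-inj (fromℕ<-injective (h x) (h y) (h< x) (h< y) eq)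

labelSum-constant : ∀ {a b s d q} p → a + b ≡ s + d → d < q →
  suc a + suc (p + (q ∸ suc d)) + suc b ≡ suc (suc (p + (s + q)))
labelSum-constant {a} {b} {s} {d} p a+b≡s+d d<q with r , refl ← m≤n⇒∃[o]m+o≡n d<q = begin
  suc a + suc (p + (suc d + r ∸ suc d)) + suc b
    ≡⟨ cong (λ x → suc a + suc (p + x) + suc b) (m+n∸m≡n (suc d) r) ⟩
  suc a + suc (p + r) + suc b                   ≡⟨ regroup a b p r ⟩
  suc (suc (suc (a + b + (p + r))))             ≡⟨ cong (λ x → suc (suc (suc (x + (p + r))))) a+b≡s+d ⟩
  suc (suc (suc (s + d + (p + r))))             ≡⟨ regroup′ s d p r ⟩
  suc (suc (p + (s + (suc d + r))))             ∎
  where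
  open ≡-Reasoning
  regroup : ∀ a b p r → suc a + suc (p + r) + suc b ≡ suc (suc (suc (a + b + (p + r))))
  regroup = solve-∀
  regroup′ : ∀ s d p r → suc (suc (suc (s + d + (p + r)))) ≡ suc (suc (p + (s + (suc d + r))))
  regroup′ = solve-∀

module _ (G : Graph) where

  edgeSum : (Fin (p G) → ℕ) → Fin (q G) → ℕ
  edgeSum ℓ e = ℓ (proj₁ (ends G e)) + ℓ (proj₂ (ends G e))

  -- Numbering the edges in decreasing order of δ makes f(x) + f(xy) + f(y) independent of the edge.
  superEdgeMagic-fromConsecutiveSums :
    (ℓ : Fin (p G) → Fin (p G)) (δ : Fin (q G) → Fin (q G)) (s : ℕ) →
    Injective _≡_ _≡_ ℓ → Injective _≡_ _≡_ δ →
    (∀ e → edgeSum (toℕ ∘ ℓ) e ≡ s + toℕ (δ e)) →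
    SuperEdgeMagic G
  superEdgeMagic-fromConsecutiveSums ℓ δ s ℓ-inj δ-inj sum≡ = record
    { f          = f
    ; bijective  = f-inj , f-surj
    ; vertLabels = λ v → subst (_< p G) (sym (toℕ-↑ˡ (ℓ v) (q G))) (toℕ<n (ℓ v))
    ; k          = suc (suc (p G + (s + q G)))
    ; magic      = magic
    }
    where
    f : Fin (p G) ⊎ Fin (q G) → Fin (p G + q G)
    f = [ (_↑ˡ q G) ∘ ℓ , (p G ↑ʳ_) ∘ opposite ∘ δ ]′

    f-inj : Injective _≡_ _≡_ f
    f-inj = [,]-injective (ℓ-inj ∘ ↑ˡ-injective (q G) _ _)
                          (δ-inj ∘ opposite-injective ∘ ↑ʳ-injective (p G) _ _)
                          (λ u e → ↑ˡ≢↑ʳ (ℓ u) (opposite (δ e)))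

    f-surj : Surjective _≡_ _≡_ f
    f-surj y with x , fx≡y ← injective⇒surjective {h = f ∘ splitAt (p G)} (splitAt-injective (p G) ∘ f-inj) y
      = splitAt (p G) x , λ { refl → fx≡y refl }

    magic : ∀ e → suc (toℕ (f (inj₁ (proj₁ (ends G e))))) + suc (toℕ (f (inj₂ e)))
                  + suc (toℕ (f (inj₁ (proj₂ (ends G e))))) ≡ suc (suc (p G + (s + q G)))
    magic e
      rewrite toℕ-↑ˡ (ℓ (proj₁ (ends G e))) (q G) | toℕ-↑ˡ (ℓ (proj₂ (ends G e))) (q G)
            | toℕ-↑ʳ (p G) (opposite (δ e)) | opposite-prop (δ e)
      = labelSum-constant (p G) (sum≡ e) (toℕ<n (δ e))

-- Isolated vertices carry no edge, so they can absorb whichever labels the rest leaves unused.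
superEdgeMagic-∪isolated : (G : Graph) (t : ℕ) (ℓ : Fin (p G) → ℕ) (δ : Fin (q G) → ℕ) (s : ℕ) →
  Injective _≡_ _≡_ ℓ → (∀ v → ℓ v < p G + t) →
  Injective _≡_ _≡_ δ → (∀ e → δ e < q G) →
  (∀ e → edgeSum G ℓ e ≡ s + δ e) →
  SuperEdgeMagic (G ∪isolated t)
superEdgeMagic-∪isolated G t ℓ δ s ℓ-inj ℓ< δ-inj δ< sum≡
  with c , c-inj , c∉ℓ ← freshInjection t (toFin ℓ ℓ<) (toFin-injective ℓ< ℓ-inj) ≤-refl
  = superEdgeMagic-fromConsecutiveSums (G ∪isolated t) ℓ′ (toFin δ δ<) s
      (splitAt-injective (p G) ∘ [,]-injective (toFin-injective ℓ< ℓ-inj) c-inj (λ v r → c∉ℓ r v ∘ sym))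
      (toFin-injective δ< δ-inj)
      sum′≡
  where
  ℓ′ : Fin (p G + t) → Fin (p G + t)
  ℓ′ = [ toFin ℓ ℓ< , c ]′ ∘ splitAt (p G)

  ℓ′-↑ˡ : ∀ v → toℕ (ℓ′ (v ↑ˡ t)) ≡ ℓ v
  ℓ′-↑ˡ v rewrite splitAt-↑ˡ (p G) v t = toℕ-fromℕ< (ℓ< v)

  sum′≡ : ∀ e → edgeSum (G ∪isolated t) (toℕ ∘ ℓ′) e ≡ s + toℕ (toFin δ δ< e)
  sum′≡ e = trans (cong₂ _+_ (ℓ′-↑ˡ _) (ℓ′-↑ˡ _)) (trans (sum≡ e) (cong (s +_) (sym (toℕ-fromℕ< (δ< e)))))

evenOrOdd : ∀ i → ∃ λ a → i ≡ a + a ⊎ i ≡ suc (a + a)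
evenOrOdd zero = 0 , inj₁ refl
evenOrOdd (suc zero) = 0 , inj₂ refl
evenOrOdd (suc (suc i)) with evenOrOdd i
... | a , inj₁ refl = suc a , inj₁ (cong suc (sym (+-suc a a)))
... | a , inj₂ refl = suc a , inj₂ (cong (suc ∘ suc) (sym (+-suc a a)))

divMod-unique : ∀ {n x y} a b .{{_ : NonZero n}} → x < n → y < n → x + a * n ≡ y + b * n → x ≡ y × a ≡ b
divMod-unique {n} {x} {y} a b x<n y<n eq =
  x≡y , *-cancelʳ-≡ a b n (+-cancelˡ-≡ x _ _ (trans eq (cong (_+ b * n) (sym x≡y))))
  where
  open ≡-Reasoning
  x≡y : x ≡ y
  x≡y = begin
    x               ≡⟨ m<n⇒m%n≡m x<n ⟨
    x % n           ≡⟨ [m+kn]%n≡m%n x a n ⟨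
    (x + a * n) % n ≡⟨ cong (_% n) eq ⟩
    (y + b * n) % n ≡⟨ [m+kn]%n≡m%n y b n ⟩
    y % n           ≡⟨ m<n⇒m%n≡m y<n ⟩
    y               ∎

-- The standard super edge-magic labeling of the cycle C_{2k+1}, with labels starting at 0.
cycleLabel : ℕ → ℕ → ℕ
cycleLabel k zero          = zero
cycleLabel k (suc zero)    = suc k
cycleLabel k (suc (suc i)) = suc (cycleLabel k i)

cycleLabel-even : ∀ k a → cycleLabel k (a + a) ≡ a
cycleLabel-even k zero    = refl
cycleLabel-even k (suc a) rewrite +-suc a a = cong suc (cycleLabel-even k a)

cycleLabel-odd : ∀ k a → cycleLabel k (suc (a + a)) ≡ suc (k + a)
cycleLabel-odd k zero    = cong suc (sym (+-identityʳ k))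
cycleLabel-odd k (suc a) rewrite +-suc a a | +-suc k a = cong suc (cycleLabel-odd k a)

cycleLabel-+-suc : ∀ k i → cycleLabel k i + cycleLabel k (suc i) ≡ k + suc i
cycleLabel-+-suc k zero          = +-comm 1 k
cycleLabel-+-suc k (suc zero)    = trans (+-comm (suc k) 1) (+-comm 2 k)
cycleLabel-+-suc k (suc (suc i)) = begin
  suc (cycleLabel k i) + suc (cycleLabel k (suc i))   ≡⟨ cong suc (+-suc _ _) ⟩
  suc (suc (cycleLabel k i + cycleLabel k (suc i)))   ≡⟨ cong (suc ∘ suc) (cycleLabel-+-suc k i) ⟩
  suc (suc (k + suc i))                               ≡⟨ cong suc (+-suc k (suc i)) ⟨
  suc (k + suc (suc i))                               ≡⟨ +-suc k (suc (suc i)) ⟨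
  k + suc (suc (suc i))                               ∎
  where open ≡-Reasoning

half-≤ : ∀ {a k} → a + a ≤ k + k → a ≤ k
half-≤ a+a≤k+k = ≮⇒≥ (λ k<a → <⇒≱ (+-mono-< k<a k<a) a+a≤k+k)

half-< : ∀ {a k} → a + a < k + k → a < k
half-< a+a<k+k = ≰⇒> (λ k≤a → <⇒≱ a+a<k+k (+-mono-≤ k≤a k≤a))

cycleLabel-< : ∀ k {i} → i < suc (k + k) → cycleLabel k i < suc (k + k)
cycleLabel-< k {i} i< with evenOrOdd i
... | a , inj₁ refl rewrite cycleLabel-even k a = s≤s (≤-trans (half-≤ (s≤s⁻¹ i<)) (m≤m+n k k))
... | a , inj₂ refl rewrite cycleLabel-odd k a = s≤s (+-monoʳ-< k (half-< (s≤s⁻¹ i<)))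

cycleLabel-injective : ∀ k {i j} → i < suc (k + k) → j < suc (k + k) →
  cycleLabel k i ≡ cycleLabel k j → i ≡ j
cycleLabel-injective k {i} {j} i< j< eq with evenOrOdd i | evenOrOdd j
... | a , inj₁ refl | b , inj₁ refl rewrite cycleLabel-even k a | cycleLabel-even k b =
  cong (λ x → x + x) eq
... | a , inj₂ refl | b , inj₂ refl rewrite cycleLabel-odd k a | cycleLabel-odd k b =
  cong (λ x → suc (x + x)) (+-cancelˡ-≡ k a b (suc-injective eq))
... | a , inj₁ refl | b , inj₂ refl rewrite cycleLabel-even k a | cycleLabel-odd k b =
  contradiction eq (<⇒≢ (s≤s (≤-trans (half-≤ (s≤s⁻¹ i<)) (m≤m+n k b))))
... | a , inj₂ refl | b , inj₁ refl rewrite cycleLabel-odd k a | cycleLabel-even k b =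
  contradiction (sym eq) (<⇒≢ (s≤s (≤-trans (half-≤ (s≤s⁻¹ j<)) (m≤m+n k a))))

toℕ-nextMod : ∀ {d} (i : Fin (suc d)) →
  toℕ i < d × toℕ (nextMod i) ≡ suc (toℕ i) ⊎ toℕ i ≡ d × toℕ (nextMod i) ≡ 0
toℕ-nextMod {d} i with toℕ i <? d
... | yes i<d = inj₁ (i<d , trans (toℕ-fromℕ< _) (m<n⇒m%n≡m (s≤s i<d)))
... | no i≮d  = inj₂ (i≡d , trans (toℕ-fromℕ< _) (trans (cong (λ x → suc x % suc d) i≡d) (n%n≡0 (suc d))))
  where
  i≡d : toℕ i ≡ d
  i≡d = ≤-antisym (s≤s⁻¹ (toℕ<n i)) (≮⇒≥ i≮d)

nextMod-injective : ∀ {d} → Injective _≡_ _≡_ (nextMod {suc d})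
nextMod-injective {d} {i} {j} eq with toℕ-nextMod i | toℕ-nextMod j
... | inj₁ (_ , i′) | inj₁ (_ , j′) = toℕ-injective (suc-injective (trans (sym i′) (trans (cong toℕ eq) j′)))
... | inj₂ (i≡d , _) | inj₂ (j≡d , _) = toℕ-injective (trans i≡d (sym j≡d))
... | inj₁ (_ , i′) | inj₂ (_ , j′) = contradiction (trans (sym i′) (trans (cong toℕ eq) j′)) λ ()
... | inj₂ (_ , i′) | inj₁ (_ , j′) = contradiction (trans (sym j′) (trans (cong toℕ (sym eq)) i′)) λ ()

cycleLabel-nextMod : ∀ k (i : Fin (suc (k + k))) →
  cycleLabel k (toℕ i) + cycleLabel k (toℕ (nextMod i)) ≡ k + toℕ (nextMod i)
cycleLabel-nextMod k i with toℕ-nextMod i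
... | inj₁ (_ , next≡) rewrite next≡ = cycleLabel-+-suc k (toℕ i)
... | inj₂ (i≡k+k , next≡) rewrite next≡ | i≡k+k = cong (_+ 0) (cycleLabel-even k k)

-- Hub l is labelled (hubBlock l) * n; block 1 is skipped because the cycle edge sums occupy it.
hubBlock : ℕ → ℕ
hubBlock zero    = zero
hubBlock (suc l) = suc (suc l)

hubBlock-injective : Injective _≡_ _≡_ hubBlock
hubBlock-injective {zero}  {zero}  _  = refl
hubBlock-injective {suc l} {suc l′} eq = cong suc (suc-injective (suc-injective eq))

hubBlock≢1 : ∀ l → hubBlock l ≢ 1
hubBlock≢1 zero    ()
hubBlock≢1 (suc l) ()

hubBlock≤ : ∀ {l m} → l < m → hubBlock l ≤ m
hubBlock≤ {zero}  _   = z≤n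
hubBlock≤ {suc l} l<m = l<m

x+b*n<n+n*m : ∀ {n m x b} → x < n → b ≤ m → x + b * n < n + n * m
x+b*n<n+n*m {n} {m} x<n b≤m = +-mono-<-≤ x<n (≤-trans (*-monoˡ-≤ n b≤m) (≤-reflexive (*-comm m n)))

remQuot-injective : ∀ {a} b → Injective _≡_ _≡_ (remQuot {a} b)
remQuot-injective {a} b {x} {y} eq =
  trans (sym (combine-remQuot {a} b x)) (trans (cong (uncurry combine) eq) (combine-remQuot {a} b y))

module CycleJoinLabeling (k m : ℕ) where

  n : ℕ
  n = suc (k + k)

  cycleVertexLabel : Fin n → ℕ
  cycleVertexLabel i = suc k + cycleLabel k (toℕ i)

  hubLabel : Fin m → ℕ
  hubLabel l = hubBlock (toℕ l) * n

  label : Fin (n + m) → ℕ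
  label = [ cycleVertexLabel , hubLabel ]′ ∘ splitAt n

  EdgeKind : Set
  EdgeKind = Fin n ⊎ (Fin n × Fin m)

  edgeKind : Fin (n + n * m) → EdgeKind
  edgeKind = [ inj₁ , inj₂ ∘ remQuot m ]′ ∘ splitAt n

  edgeCode : EdgeKind → ℕ
  edgeCode (inj₁ i)       = toℕ (nextMod i) + 1 * n
  edgeCode (inj₂ (i , l)) = cycleLabel k (toℕ i) + hubBlock (toℕ l) * n

  edgeSum≡ : ∀ e → edgeSum (cycleJoinEmpty n m) label e ≡ suc k + edgeCode (edgeKind e)
  edgeSum≡ e with splitAt n e
  ... | inj₁ i rewrite splitAt-↑ˡ n i m | splitAt-↑ˡ n (nextMod i) m = begin
    (suc k + cycleLabel k (toℕ i)) + (suc k + cycleLabel k (toℕ (nextMod i)))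
      ≡⟨ interchange (suc k) _ _ ⟩
    (suc k + suc k) + (cycleLabel k (toℕ i) + cycleLabel k (toℕ (nextMod i)))
      ≡⟨ cong ((suc k + suc k) +_) (cycleLabel-nextMod k i) ⟩
    (suc k + suc k) + (k + toℕ (nextMod i))
      ≡⟨ regroup k (toℕ (nextMod i)) ⟩
    suc k + (toℕ (nextMod i) + 1 * n)
      ∎
    where
    open ≡-Reasoning
    interchange : ∀ s a b → (s + a) + (s + b) ≡ (s + s) + (a + b)
    interchange = solve-∀
    regroup : ∀ k x → (suc k + suc k) + (k + x) ≡ suc k + (x + 1 * suc (k + k))
    regroup = solve-∀
  -- remQuot unfolds to a swapped quotRem, and it is quotRem that the definition of the edges abstracts.
  ... | inj₂ j with quotRem {n} m j
  ...   | l , i rewrite splitAt-↑ˡ n i m | splitAt-↑ʳ n m l =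
    +-assoc (suc k) (cycleLabel k (toℕ i)) (hubBlock (toℕ l) * n)

  edgeKind-injective : Injective _≡_ _≡_ edgeKind
  edgeKind-injective =
    splitAt-injective n ∘ [,]-injective inj₁-injective (remQuot-injective m ∘ inj₂-injective) (λ _ _ ())

  edgeCode-injective : Injective _≡_ _≡_ edgeCode
  edgeCode-injective {inj₁ i} {inj₁ j} eq
    with next≡ , _ ← divMod-unique {n} 1 1 (toℕ<n (nextMod i)) (toℕ<n (nextMod j)) eq
    = cong inj₁ (nextMod-injective (toℕ-injective next≡))
  edgeCode-injective {inj₁ i} {inj₂ (j , l)} eq
    with _ , 1≡block ← divMod-unique {n} 1 (hubBlock (toℕ l)) (toℕ<n (nextMod i)) (cycleLabel-< k (toℕ<n j)) eq
    = contradiction (sym 1≡block) (hubBlock≢1 (toℕ l))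
  edgeCode-injective {inj₂ (i , l)} {inj₁ j} eq
    with _ , block≡1 ← divMod-unique {n} (hubBlock (toℕ l)) 1 (cycleLabel-< k (toℕ<n i)) (toℕ<n (nextMod j)) eq
    = contradiction block≡1 (hubBlock≢1 (toℕ l))
  edgeCode-injective {inj₂ (i , l)} {inj₂ (j , l′)} eq
    with c≡ , block≡ ← divMod-unique {n} (hubBlock (toℕ l)) (hubBlock (toℕ l′))
                                       (cycleLabel-< k (toℕ<n i)) (cycleLabel-< k (toℕ<n j)) eq
    = cong inj₂ (cong₂ _,_ (toℕ-injective (cycleLabel-injective k (toℕ<n i) (toℕ<n j) c≡))
                           (toℕ-injective (hubBlock-injective block≡)))

  edgeCode-< : 1 ≤ m → ∀ κ → edgeCode κ < n + n * m
  edgeCode-< 1≤m (inj₁ i)       = x+b*n<n+n*m {n} (toℕ<n _) 1≤m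
  edgeCode-< 1≤m (inj₂ (i , l)) = x+b*n<n+n*m {n} (cycleLabel-< k (toℕ<n i)) (hubBlock≤ (toℕ<n l))

  cycleVertexLabel-< : ∀ i → cycleVertexLabel i < n + n
  cycleVertexLabel-< i = +-mono-≤-< (s≤s (m≤m+n k k)) (cycleLabel-< k (toℕ<n i))

  cycle≢hub : ∀ i l → cycleVertexLabel i ≢ hubLabel l
  cycle≢hub i l eq with toℕ l
  ... | zero   = contradiction eq λ ()
  ... | suc l′ = <⇒≱ (cycleVertexLabel-< i) (subst (n + n ≤_) (sym eq) (+-monoʳ-≤ n (m≤m+n n (l′ * n))))

  label-injective : Injective _≡_ _≡_ label
  label-injective = splitAt-injective n ∘ [,]-injective cycle-inj hub-inj cycle≢hub
    where
    cycle-inj : Injective _≡_ _≡_ cycleVertexLabel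
    cycle-inj eq = toℕ-injective (cycleLabel-injective k (toℕ<n _) (toℕ<n _) (+-cancelˡ-≡ (suc k) _ _ eq))
    hub-inj : Injective _≡_ _≡_ hubLabel
    hub-inj {l} {l′} eq =
      toℕ-injective (hubBlock-injective (*-cancelʳ-≡ (hubBlock (toℕ l)) (hubBlock (toℕ l′)) n eq))

  label-< : 2 ≤ m → ∀ v → label v < suc (m * n)
  label-< 2≤m v with splitAt n v
  ... | inj₁ i = s≤s (≤-trans (<⇒≤ (cycleVertexLabel-< i)) (n+n≤m*n 2≤m))
    where
    n+n≤m*n : ∀ {m} → 2 ≤ m → n + n ≤ m * n
    n+n≤m*n {suc (suc m′)} _ = +-monoʳ-≤ n (m≤m+n n (m′ * n))
    n+n≤m*n {suc zero} (s≤s ())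
  ... | inj₂ l = s≤s (*-monoˡ-≤ n (hubBlock≤ (toℕ<n l)))

odd⇒≡1+k+k : ∀ {n} → n % 2 ≡ 1 → ∃ λ k → n ≡ suc (k + k)
odd⇒≡1+k+k {n} n-odd = n / 2 , (begin
  n                   ≡⟨ m≡m%n+[m/n]*n n 2 ⟩
  n % 2 + n / 2 * 2   ≡⟨ cong₂ _+_ n-odd (double (n / 2)) ⟩
  suc (n / 2 + n / 2) ∎)
  where
  open ≡-Reasoning
  double : ∀ x → x * 2 ≡ x + x
  double = solve-∀

n+m≤m*n : ∀ {n m} → 2 ≤ n → 2 ≤ m → n + m ≤ m * n
n+m≤m*n {n@(suc (suc n′))} {m@(suc (suc m′))} _ _ = subst (n + m ≤_) (sym (expand n′ m′)) (m≤m+n (n + m) _)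
  where
  expand : ∀ n′ m′ → suc (suc m′) * suc (suc n′) ≡ (suc (suc n′) + suc (suc m′)) + (m′ * n′ + m′ + n′)
  expand = solve-∀
n+m≤m*n {suc zero} (s≤s ()) _
n+m≤m*n {suc (suc _)} {suc zero} _ (s≤s ())

m+[n∸m+1]≡1+n : ∀ {m n} → m ≤ n → m + (n ∸ m + 1) ≡ suc n
m+[n∸m+1]≡1+n {m} {n} m≤n =
  trans (sym (+-assoc m (n ∸ m) 1)) (trans (cong (_+ 1) (m+[n∸m]≡n m≤n)) (+-comm n 1))

theorem5 : ∀ (n m : ℕ) → n ≥ 3 → n % 2 ≡ 1 → m ≥ 2 →
    SEMDeficiency≤ (cycleJoinEmpty n m) (m * n ∸ (n + m) + 1)
theorem5 n m n≥3 n-odd m≥2 with k , refl ← odd⇒≡1+k+k {n} n-odd =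
  t , ≤-refl ,
  superEdgeMagic-∪isolated (cycleJoinEmpty n m) t label (edgeCode ∘ edgeKind) (suc k)
    label-injective (λ v → subst (label v <_) (sym p+t≡1+mn) (label-< m≥2 v))
    (edgeKind-injective ∘ edgeCode-injective) (edgeCode-< (≤-trans (s≤s z≤n) m≥2) ∘ edgeKind)
    edgeSum≡
  where
  open CycleJoinLabeling k m hiding (n)
  t : ℕ
  t = m * n ∸ (n + m) + 1
  p+t≡1+mn : (n + m) + t ≡ suc (m * n)
  p+t≡1+mn = m+[n∸m+1]≡1+n (n+m≤m*n (≤-trans (s≤s (s≤s z≤n)) n≥3) m≥2)
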